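{- Let $W$ be a Coxeter group generated by $s_1,\dots,s_n$ subject to $s_i^2=1$ and $(s_is_j)^{m_{ij}}=1$ for $i\ne j$, and suppose $m_{ij}\in\{2,\infty\}$ for all $i\ne j$. Let $t_i\neq t_j$ be reflections in $W$ (elements conjugate to simple reflections), and let $m'_{ij}$ be the order of $t_it_j$. Then $m'_{ij}=2$ or $m'_{ij}=\infty$. -}

module Defs where

open import Data.Nat using (ℕ; zero; suc; _≤_; _<_)
open import Data.Fin using (Fin)
open import Data.List using (List; []; _∷_; _++_; reverse)
open import Data.Product using (Σ; _×_)
open import Relation.Binary.PropositionalEquality using (_≡_; _≢_)
open import Relation.Nullary using (¬_)

data ℕ∞ : Set where
  fin : ℕ → ℕ∞
  ∞   : ℕ∞

-- A Coxeter matrix on generators s_1..s_n (indexed by Fin n).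
-- Off-diagonal entries are symmetric and lie in {2,3,...} ∪ {∞};
-- diagonal entries are irrelevant (s_i^2 = 1 is imposed separately).
record CoxeterMatrix (n : ℕ) : Set where
  field
    m    : Fin n → Fin n → ℕ∞
    m-sym : ∀ i j → m i j ≡ m j i
    m-≥2  : ∀ i j k → i ≢ j → m i j ≡ fin k → 2 ≤ k
open CoxeterMatrix public

Word : ℕ → Set
Word n = List (Fin n)

_^w_ : ∀ {n} → Word n → ℕ → Word n
w ^w zero  = []
w ^w suc k = w ++ (w ^w k)

data Rel {n} (M : CoxeterMatrix n) : Word n → Word n → Set where
  invol : ∀ i → Rel M (i ∷ i ∷ []) []
  braid : ∀ i j k → i ≢ j → m M i j ≡ fin k →
          Rel M ((i ∷ j ∷ []) ^w k) []

-- Equality in the Coxeter group W(M): the congruence on words generated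
-- by the relators (i.e. W = free monoid / this congruence, which is the
-- group presented by <s_i | s_i^2 = 1, (s_i s_j)^{m_ij} = 1>).
data _∣_≈_ {n} (M : CoxeterMatrix n) : Word n → Word n → Set where
  ≈-refl  : ∀ {u} → M ∣ u ≈ u
  ≈-sym   : ∀ {u v} → M ∣ u ≈ v → M ∣ v ≈ u
  ≈-trans : ∀ {u v w} → M ∣ u ≈ v → M ∣ v ≈ w → M ∣ u ≈ w
  ≈-rel   : ∀ a b {u v} → Rel M u v → M ∣ (a ++ u ++ b) ≈ (a ++ v ++ b)

-- Inverse of the element represented by w (generators are involutions)
inv : ∀ {n} → Word n → Word n
inv = reverse

IsReflection : ∀ {n} (M : CoxeterMatrix n) → Word n → Set
IsReflection {n} M t = Σ (Word n) λ g → Σ (Fin n) λ i → M ∣ t ≈ (g ++ i ∷ inv g)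

HasOrder : ∀ {n} (M : CoxeterMatrix n) → Word n → ℕ∞ → Set
HasOrder M w (fin k) =
  1 ≤ k × M ∣ (w ^w k) ≈ [] × (∀ l → 1 ≤ l → l < k → ¬ (M ∣ (w ^w l) ≈ []))
HasOrder M w ∞ = ∀ l → 1 ≤ l → ¬ (M ∣ (w ^w l) ≈ [])

-- W acts on ℤⁿ by the Tits representation: s_a is the reflection in e_a for the form
-- B(e_a, e_b) = −cos(π/m_ab), integral because m_ab ∈ {2, ∞}. Tits' argument (the image of
-- a simple root under w is either positive or w·s_a shortens, checked on alternating dihedral
-- subwords) makes the representation faithful. A reflection g s_i g⁻¹ acts as the reflection in
-- the unit vector α = g e_i, so t t′ acts as the rotation s_α s_β; put c = B(α, β). If c = 0 the
-- two reflections commute and the rotation is an involution. Otherwise c² ≥ 1, and the coordinates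
-- of (s_α s_β)ˡ β in the basis α, β have signs that forbid returning to β unless α = ±β, in which
-- case s_α = s_β. So either (t t′)² = 1 (and t t′ ≠ 1 as t ≠ t′), or no positive power of t t′ is 1.
module Submission where

open import Defs
open import Data.Nat as ℕ using (ℕ; zero; suc; z≤n; s≤s)
import Data.Nat.Properties as ℕ
open import Data.Nat.GeneralisedArithmetic using (fold)
open import Data.Nat.Induction using (<-wellFounded)
open import Induction.WellFounded using (Acc; acc)
open import Data.Fin using (Fin; zero; suc; _≟_)
open import Data.List using (List; []; _∷_; _++_; _∷ʳ_; reverse; length; initLast; _∷ʳ′_)
open import Data.List.Properties using (++-assoc; ++-identityʳ; unfold-reverse; length-++; length-++-comm)
open import Relation.Binary.Bundles using (Setoid)
import Relation.Binary.Reasoning.Setoid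
open import Data.Integer using (ℤ; +_; -[1+_]; -_; _+_; _-_; _*_; 0ℤ; 1ℤ; _≤_; +≤+)
import Data.Integer.Properties as ℤ
open import Data.Integer.Tactic.RingSolver using (solve-∀)
open import Algebra.Properties.Semiring.Sum ℤ.+-*-semiring
  using (sum; sum-syntax; ∑-distrib-+; ∑-comm; *-distribˡ-sum; sum-cong-≋; sum-replicate-zero)
open import Data.Product using (Σ; _×_; _,_; proj₁; proj₂)
open import Data.Sum using (_⊎_; inj₁; inj₂; [_,_]′)
open import Data.Empty using (⊥-elim)
open import Function using (id)
open import Relation.Binary.PropositionalEquality
open import Relation.Nullary using (¬_; Dec; yes; no)
open import Data.Fin.Properties using (all?)

length-∷ʳ : ∀ {A : Set} (w : List A) a → length (w ∷ʳ a) ≡ suc (length w)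
length-∷ʳ w a = length-++-comm w (a ∷ [])

length-<-∷ʳ : ∀ {A : Set} (w : List A) a → length w ℕ.< length (w ∷ʳ a)
length-<-∷ʳ w a = subst (length w ℕ.<_) (sym (length-∷ʳ w a)) (ℕ.n<1+n (length w))

ℤ^_ : ℕ → Set
ℤ^ k = Fin k → ℤ

e : ∀ {k} → Fin k → ℤ^ k
e zero    zero    = 1ℤ
e zero    (suc _) = 0ℤ
e (suc _) zero    = 0ℤ
e (suc a) (suc b) = e a b

e-diag : ∀ {k} (a : Fin k) → e a a ≡ 1ℤ
e-diag zero    = refl
e-diag (suc a) = e-diag a

e-nonneg : ∀ {k} (a i : Fin k) → 0ℤ ≤ e a i
e-nonneg zero    zero    = +≤+ z≤n
e-nonneg zero    (suc _) = +≤+ z≤n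
e-nonneg (suc _) zero    = +≤+ z≤n
e-nonneg (suc a) (suc i) = e-nonneg a i

[_∙_+_∙_] : ∀ {k} → ℤ → ℤ^ k → ℤ → ℤ^ k → ℤ^ k
[ p ∙ u + q ∙ w ] i = p * u i + q * w i

∑-e : ∀ {k} (f : ℤ^ k) a → ∑[ i < k ] (f i * e a i) ≡ f a
∑-e {suc k} f zero = begin
  f zero * 1ℤ + ∑[ i < k ] (f (suc i) * 0ℤ)
    ≡⟨ cong₂ _+_ (ℤ.*-identityʳ (f zero)) (sum-cong-≋ (λ i → ℤ.*-zeroʳ (f (suc i)))) ⟩
  f zero + ∑[ i < k ] 0ℤ                      ≡⟨ cong (_+_ (f zero)) (sum-replicate-zero k) ⟩
  f zero + 0ℤ                                 ≡⟨ ℤ.+-identityʳ (f zero) ⟩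
  f zero                                      ∎
  where open ≡-Reasoning
∑-e {suc k} f (suc a) = begin
  f zero * 0ℤ + ∑[ i < k ] (f (suc i) * e a i)  ≡⟨ cong₂ _+_ (ℤ.*-zeroʳ (f zero)) (∑-e (λ i → f (suc i)) a) ⟩
  0ℤ + f (suc a)                                ≡⟨ ℤ.+-identityˡ _ ⟩
  f (suc a)                                     ∎
  where open ≡-Reasoning

∑-lincomb : ∀ {k} p q (f g : ℤ^ k) →
  ∑[ i < k ] (p * f i + q * g i) ≡ p * sum f + q * sum g
∑-lincomb p q f g = begin
  ∑[ i < _ ] (p * f i + q * g i)        ≡⟨ ∑-distrib-+ (λ i → p * f i) (λ i → q * g i) ⟩
  ∑[ i < _ ] (p * f i) + ∑[ i < _ ] (q * g i)  ≡˘⟨ cong₂ _+_ (*-distribˡ-sum p f) (*-distribˡ-sum q g) ⟩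
  p * sum f + q * sum g                 ∎
  where open ≡-Reasoning

square-positive : ∀ {i} → i ≢ 0ℤ → Σ ℕ λ K → i * i ≡ 1ℤ + + K
square-positive {+ zero}  i≢0 = ⊥-elim (i≢0 refl)
square-positive {+ suc m} _   = m ℕ.+ m ℕ.* suc m , refl
square-positive { -[1+ m ]} _ = m ℕ.+ m ℕ.* suc m , refl

i*j≡0⇒j≡0 : ∀ {i j} → i ≢ 0ℤ → i * j ≡ 0ℤ → j ≡ 0ℤ
i*j≡0⇒j≡0 {i} i≢0 ij≡0 = [ (λ i≡0 → ⊥-elim (i≢0 i≡0)) , id ]′ (ℤ.i*j≡0⇒i≡0∨j≡0 i ij≡0)

module BilinearForm {k : ℕ} (G : Fin k → Fin k → ℤ) (G-sym : ∀ i j → G i j ≡ G j i) where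

  B : ℤ^ k → ℤ^ k → ℤ
  B u v = ∑[ i < k ] ∑[ j < k ] (u i * G i j * v j)

  B-congˡ : ∀ {u u′} v → u ≗ u′ → B u v ≡ B u′ v
  B-congˡ v u≗u′ = sum-cong-≋ λ i → sum-cong-≋ λ j → cong (λ x → x * G i j * v j) (u≗u′ i)

  B-congʳ : ∀ u {v v′} → v ≗ v′ → B u v ≡ B u v′
  B-congʳ u v≗v′ = sum-cong-≋ λ i → sum-cong-≋ λ j → cong (u i * G i j *_) (v≗v′ j)

  B-sym : ∀ u v → B u v ≡ B v u
  B-sym u v = trans (∑-comm (λ i j → u i * G i j * v j))
                    (sum-cong-≋ λ j → sum-cong-≋ λ i →
                       trans (cong (λ g → u i * g * v j) (G-sym i j)) (swap (u i) (G j i) (v j)))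
    where
    swap : ∀ x g y → x * g * y ≡ y * g * x
    swap = solve-∀

  B-linʳ : ∀ u p v q w → B u [ p ∙ v + q ∙ w ] ≡ p * B u v + q * B u w
  B-linʳ u p v q w = begin
    ∑[ i < k ] ∑[ j < k ] (u i * G i j * (p * v j + q * w j))
      ≡⟨ sum-cong-≋ (λ i → sum-cong-≋ λ j → distrib (u i * G i j) p (v j) q (w j)) ⟩
    ∑[ i < k ] ∑[ j < k ] (p * (u i * G i j * v j) + q * (u i * G i j * w j))
      ≡⟨ sum-cong-≋ (λ i → ∑-lincomb p q (λ j → u i * G i j * v j) (λ j → u i * G i j * w j)) ⟩
    ∑[ i < k ] (p * ∑[ j < k ] (u i * G i j * v j) + q * ∑[ j < k ] (u i * G i j * w j))
      ≡⟨ ∑-lincomb p q (λ i → ∑[ j < k ] (u i * G i j * v j)) (λ i → ∑[ j < k ] (u i * G i j * w j)) ⟩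
    p * B u v + q * B u w  ∎
    where
    open ≡-Reasoning
    distrib : ∀ a p x q y → a * (p * x + q * y) ≡ p * (a * x) + q * (a * y)
    distrib = solve-∀

  B-linˡ : ∀ p u q w v → B [ p ∙ u + q ∙ w ] v ≡ p * B u v + q * B w v
  B-linˡ p u q w v = begin
    B [ p ∙ u + q ∙ w ] v       ≡⟨ B-sym _ v ⟩
    B v [ p ∙ u + q ∙ w ]       ≡⟨ B-linʳ v p u q w ⟩
    p * B v u + q * B v w       ≡⟨ cong₂ (λ x y → p * x + q * y) (B-sym v u) (B-sym v w) ⟩
    p * B u v + q * B w v       ∎
    where open ≡-Reasoning

  B-e : ∀ a b → B (e a) (e b) ≡ G a b
  B-e a b = begin
    ∑[ i < k ] ∑[ j < k ] (e a i * G i j * e b j) ≡⟨ sum-cong-≋ (λ i → ∑-e (λ j → e a i * G i j) b) ⟩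
    ∑[ i < k ] (e a i * G i b)                   ≡⟨ sum-cong-≋ (λ i → ℤ.*-comm (e a i) (G i b)) ⟩
    ∑[ i < k ] (G i b * e a i)                   ≡⟨ ∑-e (λ i → G i b) a ⟩
    G a b                                         ∎
    where open ≡-Reasoning

  reflect : ℤ^ k → ℤ^ k → ℤ^ k
  reflect α v = [ 1ℤ ∙ v + - (+ 2 * B α v) ∙ α ]

  reflect-cong : ∀ α {v v′} → v ≗ v′ → reflect α v ≗ reflect α v′
  reflect-cong α {v} v≗v′ i = cong₂ (λ x b → 1ℤ * x + - (+ 2 * b) * α i) (v≗v′ i) (B-congʳ α v≗v′)

  Linear : (ℤ^ k → ℤ^ k) → Set
  Linear φ = ∀ p u q w → φ [ p ∙ u + q ∙ w ] ≗ [ p ∙ φ u + q ∙ φ w ]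

  Isometry : (ℤ^ k → ℤ^ k) → Set
  Isometry φ = ∀ u v → B (φ u) (φ v) ≡ B u v

  reflect-linear : ∀ α → Linear (reflect α)
  reflect-linear α p u q w i =
    trans (cong (λ b → 1ℤ * (p * u i + q * w i) + - (+ 2 * b) * α i) (B-linʳ α p u q w))
          (distrib p q (u i) (w i) (B α u) (B α w) (α i))
    where
    distrib : ∀ p q x y b c a →
      1ℤ * (p * x + q * y) + - (+ 2 * (p * b + q * c)) * a
        ≡ p * (1ℤ * x + - (+ 2 * b) * a) + q * (1ℤ * y + - (+ 2 * c) * a)
    distrib = solve-∀

  module _ (α : ℤ^ k) (α-unit : B α α ≡ 1ℤ) where

    B-reflect : ∀ v → B α (reflect α v) ≡ - B α v
    B-reflect v = begin
      B α (reflect α v)                   ≡⟨ B-linʳ α 1ℤ v (- (+ 2 * B α v)) α ⟩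
      1ℤ * B α v + - (+ 2 * B α v) * B α α ≡⟨ cong (λ b → 1ℤ * B α v + - (+ 2 * B α v) * b) α-unit ⟩
      1ℤ * B α v + - (+ 2 * B α v) * 1ℤ   ≡⟨ negate (B α v) ⟩
      - B α v                             ∎
      where
      open ≡-Reasoning
      negate : ∀ b → 1ℤ * b + - (+ 2 * b) * 1ℤ ≡ - b
      negate = solve-∀

    reflect-involutive : ∀ v → reflect α (reflect α v) ≗ v
    reflect-involutive v i =
      trans (cong (λ b → 1ℤ * reflect α v i + - (+ 2 * b) * α i) (B-reflect v)) (cancel (v i) (B α v) (α i))
      where
      cancel : ∀ x b a → 1ℤ * (1ℤ * x + - (+ 2 * b) * a) + - (+ 2 * - b) * a ≡ x
      cancel = solve-∀

    reflect-isometry : Isometry (reflect α)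
    reflect-isometry u v = begin
      B (reflect α u) (reflect α v)
        ≡⟨ B-linˡ 1ℤ u (- (+ 2 * B α u)) α (reflect α v) ⟩
      1ℤ * B u (reflect α v) + - (+ 2 * B α u) * B α (reflect α v)
        ≡⟨ cong₂ (λ x y → 1ℤ * x + - (+ 2 * B α u) * y) (B-linʳ u 1ℤ v (- (+ 2 * B α v)) α) (B-reflect v) ⟩
      1ℤ * (1ℤ * B u v + - (+ 2 * B α v) * B u α) + - (+ 2 * B α u) * - B α v
        ≡⟨ cong (λ x → 1ℤ * (1ℤ * B u v + - (+ 2 * B α v) * x) + - (+ 2 * B α u) * - B α v) (B-sym u α) ⟩
      1ℤ * (1ℤ * B u v + - (+ 2 * B α v) * B α u) + - (+ 2 * B α u) * - B α v
        ≡⟨ cancel (B u v) (B α u) (B α v) ⟩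
      B u v ∎
      where
      open ≡-Reasoning
      cancel : ∀ b x y → 1ℤ * (1ℤ * b + - (+ 2 * y) * x) + - (+ 2 * x) * - y ≡ b
      cancel = solve-∀

  reflect-orthogonal : ∀ α v → B α v ≡ 0ℤ → reflect α v ≗ v
  reflect-orthogonal α v α⊥v i =
    trans (cong (λ b → 1ℤ * v i + - (+ 2 * b) * α i) α⊥v) (drop (v i) (α i))
    where
    drop : ∀ x a → 1ℤ * x + - (+ 2 * 0ℤ) * a ≡ x
    drop = solve-∀

  B-reflect-orthogonal : ∀ γ α → B γ α ≡ 0ℤ → ∀ v → B γ (reflect α v) ≡ B γ v
  B-reflect-orthogonal γ α γ⊥α v = begin
    B γ (reflect α v)                      ≡⟨ B-linʳ γ 1ℤ v (- (+ 2 * B α v)) α ⟩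
    1ℤ * B γ v + - (+ 2 * B α v) * B γ α   ≡⟨ cong (λ b → 1ℤ * B γ v + - (+ 2 * B α v) * b) γ⊥α ⟩
    1ℤ * B γ v + - (+ 2 * B α v) * 0ℤ     ≡⟨ drop (B γ v) (B α v) ⟩
    B γ v                                  ∎
    where
    open ≡-Reasoning
    drop : ∀ x b → 1ℤ * x + - (+ 2 * b) * 0ℤ ≡ x
    drop = solve-∀

  reflect-comm : ∀ α β → B α β ≡ 0ℤ → ∀ v → reflect α (reflect β v) ≗ reflect β (reflect α v)
  reflect-comm α β α⊥β v i = begin
    1ℤ * reflect β v i + - (+ 2 * B α (reflect β v)) * α i
      ≡⟨ cong (λ b → 1ℤ * reflect β v i + - (+ 2 * b) * α i) (B-reflect-orthogonal α β α⊥β v) ⟩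
    1ℤ * reflect β v i + - (+ 2 * B α v) * α i
      ≡⟨ swap (v i) (B α v) (B β v) (α i) (β i) ⟩
    1ℤ * reflect α v i + - (+ 2 * B β v) * β i
      ≡˘⟨ cong (λ b → 1ℤ * reflect α v i + - (+ 2 * b) * β i)
               (B-reflect-orthogonal β α (trans (B-sym β α) α⊥β) v) ⟩
    1ℤ * reflect α v i + - (+ 2 * B β (reflect α v)) * β i ∎
    where
    open ≡-Reasoning
    swap : ∀ x a b s t →
      1ℤ * (1ℤ * x + - (+ 2 * b) * t) + - (+ 2 * a) * s ≡ 1ℤ * (1ℤ * x + - (+ 2 * a) * s) + - (+ 2 * b) * t
    swap = solve-∀

  reflect-orthogonal-square : ∀ {α β} → B α α ≡ 1ℤ → B β β ≡ 1ℤ → B α β ≡ 0ℤ →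
                              ∀ v → reflect α (reflect β (reflect α (reflect β v))) ≗ v
  reflect-orthogonal-square {α} {β} α-unit β-unit α⊥β v i = begin
    reflect α (reflect β (reflect α w)) i ≡˘⟨ reflect-cong α (reflect-comm α β α⊥β w) i ⟩
    reflect α (reflect α (reflect β w)) i ≡⟨ reflect-involutive α α-unit (reflect β w) i ⟩
    reflect β w i                         ≡⟨ reflect-involutive β β-unit v i ⟩
    v i                                   ∎
    where
    open ≡-Reasoning
    w = reflect β v

  reflect-conjugate : ∀ (φ ψ : ℤ^ k → ℤ^ k) → Linear φ → Isometry φ → (∀ v → φ (ψ v) ≗ v) →
                      ∀ α v → φ (reflect α (ψ v)) ≗ reflect (φ α) v
  reflect-conjugate φ ψ φ-linear φ-isometry φψ≗id α v i =
    trans (φ-linear 1ℤ (ψ v) (- (+ 2 * B α (ψ v))) α i)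
          (cong₂ (λ x b → 1ℤ * x + - (+ 2 * b) * φ α i) (φψ≗id v i) pairing)
    where
    pairing : B α (ψ v) ≡ B (φ α) v
    pairing = trans (sym (φ-isometry α (ψ v))) (B-congʳ (φ α) (φψ≗id v))

  B-scaleˡ : ∀ s {α β} → (∀ i → α i ≡ s * β i) → ∀ v → B α v ≡ s * B β v
  B-scaleˡ s {α} {β} α≗sβ v = begin
    B α v                       ≡⟨ B-congˡ v (λ i → trans (α≗sβ i) (pad s (β i))) ⟩
    B [ s ∙ β + 0ℤ ∙ β ] v      ≡⟨ B-linˡ s β 0ℤ β v ⟩
    s * B β v + 0ℤ * B β v      ≡˘⟨ pad s (B β v) ⟩
    s * B β v                   ∎
    where
    open ≡-Reasoning
    pad : ∀ s x → s * x ≡ s * x + 0ℤ * x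
    pad = solve-∀

  reflect-parallel : ∀ s {α β} → s * s ≡ 1ℤ → (∀ i → α i ≡ s * β i) → ∀ v → reflect α v ≗ reflect β v
  reflect-parallel s {α} {β} s²≡1 α≗sβ v i = begin
    1ℤ * v i + - (+ 2 * B α v) * α i
      ≡⟨ cong₂ (λ b a → 1ℤ * v i + - (+ 2 * b) * a) (B-scaleˡ s α≗sβ v) (α≗sβ i) ⟩
    1ℤ * v i + - (+ 2 * (s * B β v)) * (s * β i) ≡⟨ regroup (v i) s (B β v) (β i) ⟩
    1ℤ * v i + - (+ 2 * B β v) * ((s * s) * β i) ≡⟨ cong (λ t → 1ℤ * v i + - (+ 2 * B β v) * (t * β i)) s²≡1 ⟩
    1ℤ * v i + - (+ 2 * B β v) * (1ℤ * β i)
      ≡⟨ cong (λ t → 1ℤ * v i + - (+ 2 * B β v) * t) (ℤ.*-identityˡ (β i)) ⟩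
    1ℤ * v i + - (+ 2 * B β v) * β i           ∎
    where
    open ≡-Reasoning
    regroup : ∀ x s b a → 1ℤ * x + - (+ 2 * (s * b)) * (s * a) ≡ 1ℤ * x + - (+ 2 * b) * ((s * s) * a)
    regroup = solve-∀

  module Rotation (α β : ℤ^ k) (α-unit : B α α ≡ 1ℤ) (β-unit : B β β ≡ 1ℤ) where

    c : ℤ
    c = B α β

    rotation : ℤ^ k → ℤ^ k
    rotation v = reflect α (reflect β v)

    rotation-cong : ∀ {v v′} → v ≗ v′ → rotation v ≗ rotation v′
    rotation-cong v≗v′ = reflect-cong α (reflect-cong β v≗v′)

    span : ℤ × ℤ → ℤ^ k
    span (x , y) = [ x ∙ α + y ∙ β ]

    next : ℤ × ℤ → ℤ × ℤ
    next (x , y) = (+ 4 * c * c - 1ℤ) * x + + 2 * c * y , - (+ 2 * c * x) - y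

    B-span : ∀ γ x y → B γ (span (x , y)) ≡ x * B γ α + y * B γ β
    B-span γ x y = B-linʳ γ x α y β

    rotation-span : ∀ xy → rotation (span xy) ≗ span (next xy)
    rotation-span (x , y) i =
      trans (cong₂ (λ a b → 1ℤ * (1ℤ * (x * α i + y * β i) + - (+ 2 * b) * β i) + - (+ 2 * a) * α i) pairα pairβ)
            (expand x y c (α i) (β i))
      where
      u = span (x , y)
      pairβ : B β u ≡ x * c + y
      pairβ = trans (B-span β x y) (trans (cong₂ (λ a b → x * a + y * b) (B-sym β α) β-unit)
                                          (cong (_+_ (x * c)) (ℤ.*-identityʳ y)))
      pairα : B α (reflect β u) ≡ x + y * c - + 2 * (x * c + y) * c
      pairα = begin
        B α (reflect β u)                          ≡⟨ B-linʳ α 1ℤ u (- (+ 2 * B β u)) β ⟩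
        1ℤ * B α u + - (+ 2 * B β u) * c           ≡⟨ cong₂ (λ a b → 1ℤ * a + - (+ 2 * b) * c) (B-span α x y) pairβ ⟩
        1ℤ * (x * B α α + y * c) + - (+ 2 * (x * c + y)) * c
                                                   ≡⟨ cong (λ a → 1ℤ * (x * a + y * c) + - (+ 2 * (x * c + y)) * c) α-unit ⟩
        1ℤ * (x * 1ℤ + y * c) + - (+ 2 * (x * c + y)) * c ≡⟨ simplify x y c ⟩
        x + y * c - + 2 * (x * c + y) * c          ∎
        where
        open ≡-Reasoning
        simplify : ∀ x y c → 1ℤ * (x * 1ℤ + y * c) + - (+ 2 * (x * c + y)) * c ≡ x + y * c - + 2 * (x * c + y) * c
        simplify = solve-∀
      expand : ∀ x y c a b →
        1ℤ * (1ℤ * (x * a + y * b) + - (+ 2 * (x * c + y)) * b) + - (+ 2 * (x + y * c - + 2 * (x * c + y) * c)) * a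
          ≡ ((+ 4 * c * c - 1ℤ) * x + + 2 * c * y) * a + (- (+ 2 * c * x) - y) * b
      expand = solve-∀

    rotation-orbit : ∀ l → fold β rotation l ≗ span (fold (0ℤ , 1ℤ) next l)
    rotation-orbit zero i = sym (unit-coordinate (α i) (β i))
      where
      unit-coordinate : ∀ a b → 0ℤ * a + 1ℤ * b ≡ b
      unit-coordinate = solve-∀
    rotation-orbit (suc l) i = trans (rotation-cong (rotation-orbit l) i) (rotation-span (fold (0ℤ , 1ℤ) next l) i)

    -- y ≤ −1 and c x + y ≥ 0, witnessed in ℕ; once c² ≥ 1 this sign pattern is invariant under next.
    Escaping : ℤ × ℤ → Set
    Escaping (x , y) = Σ ℕ λ d → Σ ℕ λ z → c * x + y ≡ + d × y ≡ -[1+ z ]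

    module _ {K : ℕ} (c²≡1+K : c * c ≡ 1ℤ + + K) where

      escaping-start : Escaping (next (0ℤ , 1ℤ))
      escaping-start =
        suc (K ℕ.+ K) , 0 , trans (start c) (trans (cong (λ s → + 2 * s - 1ℤ) c²≡1+K) (double (+ K))) , minus-one c
        where
        minus-one : ∀ c → - (+ 2 * c * 0ℤ) - 1ℤ ≡ - 1ℤ
        minus-one = solve-∀
        double : ∀ K → + 2 * (1ℤ + K) - 1ℤ ≡ 1ℤ + (K + K)
        double = solve-∀
        start : ∀ c → c * ((+ 4 * c * c - 1ℤ) * 0ℤ + + 2 * c * 1ℤ) + (- (+ 2 * c * 0ℤ) - 1ℤ) ≡ + 2 * (c * c) - 1ℤ
        start = solve-∀

      escaping-next : ∀ {xy} → Escaping xy → Escaping (next xy)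
      escaping-next {x , y} (d , z , cx+y≡d , y≡-1-z) =
        4 ℕ.* K ℕ.* d ℕ.+ d ℕ.+ 2 ℕ.* K ℕ.* suc z , d ℕ.+ d ℕ.+ z , cx′+y′ , y′
        where
        open ≡-Reasoning
        pos-*³ : ∀ a b c → + (a ℕ.* b ℕ.* c) ≡ + a * + b * + c
        pos-*³ a b c = trans (ℤ.pos-* (a ℕ.* b) c) (cong (_* + c) (ℤ.pos-* a b))
        cx′+y′ : c * ((+ 4 * c * c - 1ℤ) * x + + 2 * c * y) + (- (+ 2 * c * x) - y)
                   ≡ + (4 ℕ.* K ℕ.* d ℕ.+ d ℕ.+ 2 ℕ.* K ℕ.* suc z)
        cx′+y′ = begin
          c * ((+ 4 * c * c - 1ℤ) * x + + 2 * c * y) + (- (+ 2 * c * x) - y)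
            ≡⟨ regroup c x y ⟩
          (+ 4 * (c * c) - + 3) * (c * x + y) + (+ 2 * (c * c) - + 2) * - y
            ≡⟨ cong (λ s → (+ 4 * s - + 3) * (c * x + y) + (+ 2 * s - + 2) * - y) c²≡1+K ⟩
          (+ 4 * (1ℤ + + K) - + 3) * (c * x + y) + (+ 2 * (1ℤ + + K) - + 2) * - y
            ≡⟨ cong₂ (λ a b → (+ 4 * (1ℤ + + K) - + 3) * a + (+ 2 * (1ℤ + + K) - + 2) * - b) cx+y≡d y≡-1-z ⟩
          (+ 4 * (1ℤ + + K) - + 3) * + d + (+ 2 * (1ℤ + + K) - + 2) * (1ℤ + + z)
            ≡⟨ expand (+ K) (+ d) (+ z) ⟩
          + 4 * + K * + d + + d + + 2 * + K * (1ℤ + + z)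
            ≡˘⟨ cong₂ (λ a b → a + + d + b) (pos-*³ 4 K d) (pos-*³ 2 K (suc z)) ⟩
          + (4 ℕ.* K ℕ.* d ℕ.+ d ℕ.+ 2 ℕ.* K ℕ.* suc z) ∎
          where
          regroup : ∀ c x y → c * ((+ 4 * c * c - 1ℤ) * x + + 2 * c * y) + (- (+ 2 * c * x) - y)
                                ≡ (+ 4 * (c * c) - + 3) * (c * x + y) + (+ 2 * (c * c) - + 2) * - y
          regroup = solve-∀
          expand : ∀ K d z → (+ 4 * (1ℤ + K) - + 3) * d + (+ 2 * (1ℤ + K) - + 2) * (1ℤ + z)
                               ≡ + 4 * K * d + d + + 2 * K * (1ℤ + z)
          expand = solve-∀
        y′ : - (+ 2 * c * x) - y ≡ -[1+ d ℕ.+ d ℕ.+ z ]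
        y′ = begin
          - (+ 2 * c * x) - y            ≡⟨ regroup c x y ⟩
          - (+ 2 * (c * x + y)) + y      ≡⟨ cong₂ (λ a b → - (+ 2 * a) + b) cx+y≡d y≡-1-z ⟩
          - (+ 2 * + d) + - (1ℤ + + z)   ≡⟨ collect (+ d) (+ z) ⟩
          - (1ℤ + (+ d + + d + + z))     ∎
          where
          regroup : ∀ c x y → - (+ 2 * c * x) - y ≡ - (+ 2 * (c * x + y)) + y
          regroup = solve-∀
          collect : ∀ d z → - (+ 2 * d) + - (1ℤ + z) ≡ - (1ℤ + (d + d + z))
          collect = solve-∀

      escaping-orbit : ∀ l → Escaping (fold (0ℤ , 1ℤ) next (suc l))
      escaping-orbit zero    = escaping-start
      escaping-orbit (suc l) = escaping-next (escaping-orbit l)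

    escaping-fixed⇒parallel : ∀ {xy} → Escaping xy → span xy ≗ β → c * c ≡ 1ℤ × (∀ i → α i ≡ c * β i)
    escaping-fixed⇒parallel {x , y} (d , z , _ , y≡-1-z) fixed = c²≡1 , α≗cβ
      where
      open ≡-Reasoning
      pairα : x * 1ℤ + y * c ≡ c
      pairα = begin
        x * 1ℤ + y * c     ≡˘⟨ cong (λ a → x * a + y * c) α-unit ⟩
        x * B α α + y * c  ≡˘⟨ B-span α x y ⟩
        B α (span (x , y)) ≡⟨ B-congʳ α fixed ⟩
        c                  ∎
      pairβ : x * c + y * 1ℤ ≡ 1ℤ
      pairβ = begin
        x * c + y * 1ℤ         ≡˘⟨ cong₂ (λ a b → x * a + y * b) (B-sym β α) β-unit ⟩
        x * B β α + y * B β β  ≡˘⟨ B-span β x y ⟩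
        B β (span (x , y))     ≡⟨ trans (B-congʳ β fixed) β-unit ⟩
        1ℤ                     ∎
      cx≡1-y : c * x ≡ 1ℤ - y
      cx≡1-y = trans (isolate x y c) (cong (_- y) pairβ)
        where
        isolate : ∀ x y c → c * x ≡ (x * c + y * 1ℤ) - y
        isolate = solve-∀
      x≢0 : x ≢ 0ℤ
      x≢0 x≡0 with () ← begin
        0ℤ         ≡˘⟨ ℤ.*-zeroʳ c ⟩
        c * 0ℤ     ≡˘⟨ cong (c *_) x≡0 ⟩
        c * x      ≡⟨ cx≡1-y ⟩
        1ℤ - y     ≡⟨ cong (_-_ 1ℤ) y≡-1-z ⟩
        + suc (suc z) ∎
      c²≡1 : c * c ≡ 1ℤ
      c²≡1 = sym (ℤ.i-j≡0⇒i≡j 1ℤ (c * c) (i*j≡0⇒j≡0 x≢0 (begin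
        x * (1ℤ - c * c)                     ≡⟨ expand x y c ⟩
        (x * 1ℤ + y * c) - c * (x * c + y * 1ℤ) ≡⟨ cong₂ (λ a b → a - c * b) pairα pairβ ⟩
        c - c * 1ℤ                           ≡⟨ cancel c ⟩
        0ℤ                                   ∎)))
        where
        expand : ∀ x y c → x * (1ℤ - c * c) ≡ (x * 1ℤ + y * c) - c * (x * c + y * 1ℤ)
        expand = solve-∀
        cancel : ∀ c → c - c * 1ℤ ≡ 0ℤ
        cancel = solve-∀
      α≗cβ : ∀ i → α i ≡ c * β i
      α≗cβ i = ℤ.i-j≡0⇒i≡j (α i) (c * β i) (i*j≡0⇒j≡0 x≢0 (begin
        x * (α i - c * β i)                              ≡⟨ expand x y c (α i) (β i) ⟩
        ((x * α i + y * β i) - β i) + ((1ℤ - y) - c * x) * β i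
          ≡⟨ cong₂ (λ a b → (a - β i) + ((1ℤ - y) - b) * β i) (fixed i) cx≡1-y ⟩
        (β i - β i) + ((1ℤ - y) - (1ℤ - y)) * β i          ≡⟨ cancel (β i) (1ℤ - y) ⟩
        0ℤ                                               ∎))
        where
        expand : ∀ x y c a b → x * (a - c * b) ≡ ((x * a + y * b) - b) + ((1ℤ - y) - c * x) * b
        expand = solve-∀
        cancel : ∀ b t → (b - b) + (t - t) * b ≡ 0ℤ
        cancel = solve-∀

    rotation-periodic⇒involutive : ∀ l → fold β rotation (suc l) ≗ β → ∀ v → rotation (rotation v) ≗ v
    rotation-periodic⇒involutive l periodic = by-cases (c ℤ.≟ 0ℤ)
      where
      by-cases : Dec (c ≡ 0ℤ) → ∀ v → rotation (rotation v) ≗ v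
      by-cases (yes α⊥β) = reflect-orthogonal-square α-unit β-unit α⊥β
      by-cases (no c≢0) v i = trans (rotation-cong (trivial v) i) (trivial v i)
        where
        fixed : span (fold (0ℤ , 1ℤ) next (suc l)) ≗ β
        fixed j = trans (sym (rotation-orbit (suc l) j)) (periodic j)
        parallel : c * c ≡ 1ℤ × (∀ j → α j ≡ c * β j)
        parallel = escaping-fixed⇒parallel (escaping-orbit (proj₂ (square-positive c≢0)) l) fixed
        trivial : ∀ u → rotation u ≗ u
        trivial u j = trans (reflect-parallel c (proj₁ parallel) (proj₂ parallel) (reflect β u) j)
                            (reflect-involutive β β-unit u j)

module WordCongruence {n} (M : CoxeterMatrix n) where

  ≈-setoid : Setoid _ _
  ≈-setoid = record
    { Carrier       = Word n
    ; _≈_           = M ∣_≈_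
    ; isEquivalence = record { refl = ≈-refl ; sym = ≈-sym ; trans = ≈-trans }
    }

  module ≈-Reasoning = Relation.Binary.Reasoning.Setoid ≈-setoid

  ≈-context : ∀ {u w} → M ∣ u ≈ w → ∀ a b → M ∣ (a ++ u ++ b) ≈ (a ++ w ++ b)
  ≈-context ≈-refl          a b = ≈-refl
  ≈-context (≈-sym p)       a b = ≈-sym (≈-context p a b)
  ≈-context (≈-trans p q)   a b = ≈-trans (≈-context p a b) (≈-context q a b)
  ≈-context (≈-rel a′ b′ {u} {w} r) a b = subst₂ (M ∣_≈_) (regroup u) (regroup w) (≈-rel (a ++ a′) (b′ ++ b) r)
    where
    regroup : ∀ x → (a ++ a′) ++ x ++ b′ ++ b ≡ a ++ (a′ ++ x ++ b′) ++ b
    regroup x = trans (++-assoc a a′ (x ++ b′ ++ b))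
                      (cong (a ++_) (sym (trans (++-assoc a′ (x ++ b′) b) (cong (a′ ++_) (++-assoc x b′ b)))))

  ≈-++ : ∀ {u u′ w w′} → M ∣ u ≈ u′ → M ∣ w ≈ w′ → M ∣ (u ++ w) ≈ (u′ ++ w′)
  ≈-++ {u} {u′} {w} {w′} u≈u′ w≈w′ = begin
    u ++ w          ≈⟨ ≈-context u≈u′ [] w ⟩
    u′ ++ w         ≡˘⟨ cong (u′ ++_) (++-identityʳ w) ⟩
    u′ ++ w ++ []   ≈⟨ ≈-context w≈w′ u′ [] ⟩
    u′ ++ w′ ++ []  ≡⟨ cong (u′ ++_) (++-identityʳ w′) ⟩
    u′ ++ w′        ∎
    where open ≈-Reasoning

  ≈-cancel : ∀ w x → M ∣ (w ∷ʳ x ∷ʳ x) ≈ w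
  ≈-cancel w x = begin
    w ∷ʳ x ∷ʳ x          ≡⟨ ++-assoc w (x ∷ []) (x ∷ []) ⟩
    w ++ x ∷ x ∷ [] ++ []  ≈⟨ ≈-rel w [] (invol x) ⟩
    w ++ [] ++ []          ≡⟨ ++-identityʳ w ⟩
    w                      ∎
    where open ≈-Reasoning

  ≈-unsnoc : ∀ {v v′ x} → M ∣ (v ∷ʳ x) ≈ v′ → M ∣ v ≈ (v′ ∷ʳ x)
  ≈-unsnoc {v} {v′} {x} vx≈v′ = begin
    v            ≈˘⟨ ≈-cancel v x ⟩
    v ∷ʳ x ∷ʳ x  ≈⟨ ≈-++ vx≈v′ ≈-refl ⟩
    v′ ∷ʳ x      ∎
    where open ≈-Reasoning

  ≈-commute : ∀ {a b} → a ≢ b → m M a b ≡ fin 2 → M ∣ (b ∷ a ∷ []) ≈ (a ∷ b ∷ [])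
  ≈-commute {a} {b} a≢b m≡2 = begin
    b ∷ a ∷ []                  ≈˘⟨ ≈-rel (b ∷ a ∷ []) [] (braid a b 2 a≢b m≡2) ⟩
    b ∷ a ∷ a ∷ b ∷ a ∷ b ∷ []  ≈⟨ ≈-rel (b ∷ []) (b ∷ a ∷ b ∷ []) (invol a) ⟩
    b ∷ b ∷ a ∷ b ∷ []          ≈⟨ ≈-rel [] (a ∷ b ∷ []) (invol b) ⟩
    a ∷ b ∷ []                  ∎
    where open ≈-Reasoning

  product-trivial⇒equal : ∀ {t t′} → M ∣ (t′ ++ t′) ≈ [] → M ∣ (t ++ t′) ≈ [] → M ∣ t ≈ t′
  product-trivial⇒equal {t} {t′} t′²≈[] tt′≈[] = begin
    t                ≡˘⟨ ++-identityʳ t ⟩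
    t ++ []          ≈˘⟨ ≈-++ (≈-refl {u = t}) t′²≈[] ⟩
    t ++ t′ ++ t′    ≡˘⟨ ++-assoc t t′ t′ ⟩
    (t ++ t′) ++ t′  ≈⟨ ≈-++ tt′≈[] ≈-refl ⟩
    t′               ∎
    where open ≈-Reasoning

  has-order-two : ∀ {t t′} → M ∣ (t′ ++ t′) ≈ [] → ¬ (M ∣ t ≈ t′) → M ∣ ((t ++ t′) ^w 2) ≈ [] →
                  HasOrder M (t ++ t′) (fin 2)
  has-order-two {t} {t′} t′²≈[] t≉t′ square≈[] = s≤s z≤n , square≈[] , not-one
    where
    not-one : ∀ l → 1 ℕ.≤ l → l ℕ.< 2 → ¬ (M ∣ ((t ++ t′) ^w l) ≈ [])
    not-one (suc zero) _ _ tt′≈[] =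
      t≉t′ (product-trivial⇒equal t′²≈[] (subst (M ∣_≈ []) (++-identityʳ (t ++ t′)) tt′≈[]))
    not-one (suc (suc _)) _ (s≤s (s≤s ()))

RightAngled : ∀ {n} → CoxeterMatrix n → Set
RightAngled {n} M = ∀ i j → i ≢ j → m M i j ≡ fin 2 ⊎ m M i j ≡ ∞

-- −cos(π/m) for the values m = 2 and m = ∞ that occur; other finite m get the junk value 0.
−cosπ/ : ℕ∞ → ℤ
−cosπ/ (fin _) = 0ℤ
−cosπ/ ∞       = - 1ℤ

module Representation {n} (M : CoxeterMatrix n) (right-angled : RightAngled M) where

  open WordCongruence M

  gram : Fin n → Fin n → ℤ
  gram a b with a ≟ b
  ... | yes _ = 1ℤ
  ... | no _  = −cosπ/ (m M a b)

  gram-diag : ∀ a → gram a a ≡ 1ℤ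
  gram-diag a with a ≟ a
  ... | yes _  = refl
  ... | no a≢a = ⊥-elim (a≢a refl)

  gram-off : ∀ {a b} → a ≢ b → gram a b ≡ −cosπ/ (m M a b)
  gram-off {a} {b} a≢b with a ≟ b
  ... | yes a≡b = ⊥-elim (a≢b a≡b)
  ... | no _    = refl

  gram-sym : ∀ a b → gram a b ≡ gram b a
  gram-sym a b with a ≟ b | b ≟ a
  ... | yes _   | yes _   = refl
  ... | yes a≡b | no b≢a  = ⊥-elim (b≢a (sym a≡b))
  ... | no a≢b  | yes b≡a = ⊥-elim (a≢b (sym b≡a))
  ... | no _    | no _    = cong −cosπ/ (m-sym M a b)

  open BilinearForm gram gram-sym public

  e-unit : ∀ a → B (e a) (e a) ≡ 1ℤ
  e-unit a = trans (B-e a a) (gram-diag a)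

  e-orthogonal : ∀ {a b} → a ≢ b → m M a b ≡ fin 2 → B (e a) (e b) ≡ 0ℤ
  e-orthogonal {a} {b} a≢b m≡2 = trans (B-e a b) (trans (gram-off a≢b) (cong −cosπ/ m≡2))

  e-free : ∀ {a b} → a ≢ b → m M a b ≡ ∞ → B (e a) (e b) ≡ - 1ℤ
  e-free {a} {b} a≢b m≡∞ = trans (B-e a b) (trans (gram-off a≢b) (cong −cosπ/ m≡∞))

  σ : Fin n → ℤ^ n → ℤ^ n
  σ a = reflect (e a)

  ρ : Word n → ℤ^ n → ℤ^ n
  ρ []      v = v
  ρ (a ∷ w) v = σ a (ρ w v)

  ρ-++ : ∀ u w v → ρ (u ++ w) v ≡ ρ u (ρ w v)
  ρ-++ []      w v = refl
  ρ-++ (a ∷ u) w v = cong (σ a) (ρ-++ u w v)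

  ρ-cong : ∀ w {v v′} → v ≗ v′ → ρ w v ≗ ρ w v′
  ρ-cong []      v≗v′ = v≗v′
  ρ-cong (a ∷ w) v≗v′ = reflect-cong (e a) (ρ-cong w v≗v′)

  ρ-linear : ∀ w → Linear (ρ w)
  ρ-linear []      p u q w′ i = refl
  ρ-linear (a ∷ w) p u q w′ i =
    trans (reflect-cong (e a) (ρ-linear w p u q w′) i) (reflect-linear (e a) p (ρ w u) q (ρ w w′) i)

  ρ-isometry : ∀ w → Isometry (ρ w)
  ρ-isometry []      u v = refl
  ρ-isometry (a ∷ w) u v = trans (reflect-isometry (e a) (e-unit a) (ρ w u) (ρ w v)) (ρ-isometry w u v)

  ρ-reverse : ∀ w v → ρ w (ρ (reverse w) v) ≗ v
  ρ-reverse []      v i = refl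
  ρ-reverse (a ∷ w) v i rewrite unfold-reverse a w | ρ-++ (reverse w) (a ∷ []) v =
    trans (reflect-cong (e a) (ρ-reverse w (σ a v)) i) (reflect-involutive (e a) (e-unit a) v i)

  ρ-relator : ∀ {u w} → Rel M u w → ∀ v → ρ u v ≗ ρ w v
  ρ-relator (invol a) v = reflect-involutive (e a) (e-unit a) v
  ρ-relator (braid a b k a≢b m≡k) v with right-angled a b a≢b
  ... | inj₂ m≡∞ with () ← trans (sym m≡k) m≡∞
  ... | inj₁ m≡2 with refl ← trans (sym m≡k) m≡2 =
    reflect-orthogonal-square (e-unit a) (e-unit b) (e-orthogonal a≢b m≡2) v

  ρ-resp : ∀ {u w} → M ∣ u ≈ w → ∀ v → ρ u v ≗ ρ w v
  ρ-resp ≈-refl        v i = refl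
  ρ-resp (≈-sym p)     v i = sym (ρ-resp p v i)
  ρ-resp (≈-trans p q) v i = trans (ρ-resp p v i) (ρ-resp q v i)
  ρ-resp (≈-rel a b {u} {w} r) v i
    rewrite ρ-++ a (u ++ b) v | ρ-++ u b v | ρ-++ a (w ++ b) v | ρ-++ w b v = ρ-cong a (ρ-relator r (ρ b v)) i

  root : Word n → Fin n → ℤ^ n
  root g a = ρ g (e a)

  root-unit : ∀ g a → B (root g a) (root g a) ≡ 1ℤ
  root-unit g a = trans (ρ-isometry g (e a) (e a)) (e-unit a)

  ρ-reflection : ∀ {t g a} → M ∣ t ≈ (g ++ a ∷ inv g) → ∀ v → ρ t v ≗ reflect (root g a) v
  ρ-reflection {t} {g} {a} t≈gag⁻¹ v i = begin
    ρ t v i                          ≡⟨ ρ-resp t≈gag⁻¹ v i ⟩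
    ρ (g ++ a ∷ reverse g) v i       ≡⟨ cong (λ u → u i) (ρ-++ g (a ∷ reverse g) v) ⟩
    ρ g (σ a (ρ (reverse g) v)) i
      ≡⟨ reflect-conjugate (ρ g) (ρ (reverse g)) (ρ-linear g) (ρ-isometry g) (ρ-reverse g) (e a) v i ⟩
    reflect (root g a) v i           ∎
    where open ≡-Reasoning

module Tits {n} (M : CoxeterMatrix n) (right-angled : RightAngled M) where

  open WordCongruence M
  open Representation M right-angled

  Positive : ℤ^ n → Set
  Positive v = ∀ i → 0ℤ ≤ v i

  Descent : Word n → Fin n → Set
  Descent w a = Σ (Word n) λ w′ → M ∣ (w ∷ʳ a) ≈ w′ × length w′ ℕ.< length w

  PositiveOrDescent : Word n → Fin n → Set
  PositiveOrDescent w a = Positive (root w a) ⊎ Descent w a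

  positive-or-descent-resp : ∀ {w w′ a} → M ∣ w ≈ w′ → length w′ ℕ.≤ length w →
                             PositiveOrDescent w′ a → PositiveOrDescent w a
  positive-or-descent-resp {a = a} w≈w′ _ (inj₁ positive) =
    inj₁ λ i → subst (0ℤ ≤_) (sym (ρ-resp w≈w′ (e a) i)) (positive i)
  positive-or-descent-resp w≈w′ w′≤w (inj₂ (w″ , w′a≈w″ , w″<w′)) =
    inj₂ (w″ , ≈-trans (≈-++ w≈w′ ≈-refl) w′a≈w″ , ℕ.<-≤-trans w″<w′ w′≤w)

  positive-span : ∀ w {x y} → Positive (root w x) → Positive (root w y) →
                  ∀ p q → Positive (ρ w [ + p ∙ e x + + q ∙ e y ])
  positive-span w {x} {y} x-positive y-positive p q i =
    subst (0ℤ ≤_) (sym (ρ-linear w (+ p) (e x) (+ q) (e y) i)) (nonneg (x-positive i) (y-positive i))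
    where
    nonneg : ∀ {a b} → 0ℤ ≤ a → 0ℤ ≤ b → 0ℤ ≤ + p * a + + q * b
    nonneg {+ a} {+ b} _ _ = subst (0ℤ ≤_) (cong₂ _+_ (ℤ.pos-* p a) (ℤ.pos-* q b)) (+≤+ z≤n)

  alt : ℕ → Fin n → Fin n → Word n
  alt zero    x y = []
  alt (suc k) x y = x ∷ alt k y x

  -- alt k x y ∷ʳ after k x y is still alternating
  after : ℕ → Fin n → Fin n → Fin n
  after zero    x y = x
  after (suc k) x y = after k y x

  length-alt : ∀ k x y → length (alt k x y) ≡ k
  length-alt zero    x y = refl
  length-alt (suc k) x y = cong suc (length-alt k y x)

  length-++-alt : ∀ v k x y → length (v ++ alt k x y) ≡ length v ℕ.+ k
  length-++-alt v k x y = trans (length-++ v) (cong (length v ℕ.+_) (length-alt k x y))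

  Free : Fin n → Fin n → Set
  Free x y = x ≢ y × m M x y ≡ ∞

  Free-sym : ∀ {x y} → Free x y → Free y x
  Free-sym {x} {y} (x≢y , m≡∞) = (λ y≡x → x≢y (sym y≡x)) , trans (m-sym M y x) m≡∞

  ρ-alt : ∀ {x y} → Free x y → ∀ k → ρ (alt k x y) (e (after k x y)) ≗ [ + suc k ∙ e x + + k ∙ e y ]
  ρ-alt {x} {y} _ zero i = as-combination (e x i) (e y i)
    where
    as-combination : ∀ a b → a ≡ + 1 * a + + 0 * b
    as-combination = solve-∀
  ρ-alt {x} {y} free@(x≢y , m≡∞) (suc k) i = begin
    σ x (ρ (alt k y x) (e (after k y x))) i
      ≡⟨ reflect-cong (e x) (ρ-alt (Free-sym free) k) i ⟩
    σ x [ + suc k ∙ e y + + k ∙ e x ] i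
      ≡⟨ reflect-linear (e x) (+ suc k) (e y) (+ k) (e x) i ⟩
    + suc k * (1ℤ * e y i + - (+ 2 * B (e x) (e y)) * e x i) + + k * (1ℤ * e x i + - (+ 2 * B (e x) (e x)) * e x i)
      ≡⟨ cong₂ (λ b b′ → + suc k * (1ℤ * e y i + - (+ 2 * b) * e x i) + + k * (1ℤ * e x i + - (+ 2 * b′) * e x i))
               (e-free x≢y m≡∞) (e-unit x) ⟩
    (1ℤ + + k) * (1ℤ * e y i + - (+ 2 * - 1ℤ) * e x i) + + k * (1ℤ * e x i + - (+ 2 * 1ℤ) * e x i)
      ≡⟨ collect (+ k) (e x i) (e y i) ⟩
    (1ℤ + (1ℤ + + k)) * e x i + (1ℤ + + k) * e y i
      ∎
    where
    open ≡-Reasoning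
    collect : ∀ k a b → (1ℤ + k) * (1ℤ * b + - (+ 2 * - 1ℤ) * a) + k * (1ℤ * a + - (+ 2 * 1ℤ) * a)
                         ≡ (1ℤ + (1ℤ + k)) * a + (1ℤ + k) * b
    collect = solve-∀

  module _ (w₀ : Word n) (shorter : ∀ w → length w ℕ.< length w₀ → ∀ a → PositiveOrDescent w a) where

    -- Move descents of v at x or y into the alternating tail (this never lengthens the word)
    -- until there are none; then ρ v is positive on e x and e y, and ρ-alt finishes.
    alternating-positive-or-descent :
      ∀ v → Acc ℕ._<_ (length v) → length v ℕ.< length w₀ →
      ∀ {x y} → Free x y → ∀ k → PositiveOrDescent (v ++ alt k x y) (after k x y)
    alternating-positive-or-descent v _ v<w₀ {x} _ zero =
      subst (λ u → PositiveOrDescent u x) (sym (++-identityʳ v)) (shorter v v<w₀ x)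
    alternating-positive-or-descent v (acc rs) v<w₀ {x} {y} free (suc k) =
      by-cases (shorter v v<w₀ x) (shorter v v<w₀ y)
      where
      open ≈-Reasoning
      recurse : ∀ {v′} → length v′ ℕ.< length v → ∀ k′ → PositiveOrDescent (v′ ++ alt k′ y x) (after k′ y x)
      recurse {v′} v′<v = alternating-positive-or-descent v′ (rs v′<v) (ℕ.<-trans v′<v v<w₀) (Free-sym free)
      by-cases : PositiveOrDescent v x → PositiveOrDescent v y →
                 PositiveOrDescent (v ++ alt (suc k) x y) (after (suc k) x y)
      by-cases (inj₁ x-positive) (inj₁ y-positive) = inj₁ λ i →
        subst (0ℤ ≤_) (sym (trans (cong (λ u → u i) (ρ-++ v (alt (suc k) x y) (e (after (suc k) x y))))
                                  (ρ-cong v (ρ-alt free (suc k)) i)))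
              (positive-span v {x} {y} x-positive y-positive (suc (suc k)) (suc k) i)
      by-cases (inj₂ (v′ , vx≈v′ , v′<v)) _ =
        positive-or-descent-resp cancel-x (≤-length v′<v) (recurse v′<v k)
        where
        cancel-x : M ∣ (v ++ alt (suc k) x y) ≈ (v′ ++ alt k y x)
        cancel-x = begin
          v ++ x ∷ alt k y x                ≈⟨ ≈-++ (≈-unsnoc vx≈v′) ≈-refl ⟩
          (v′ ∷ʳ x) ++ x ∷ alt k y x        ≡⟨ ++-assoc v′ (x ∷ []) (x ∷ alt k y x) ⟩
          v′ ++ x ∷ x ∷ alt k y x           ≈⟨ ≈-rel v′ (alt k y x) (invol x) ⟩
          v′ ++ alt k y x                   ∎
        ≤-length : length v′ ℕ.< length v → length (v′ ++ alt k y x) ℕ.≤ length (v ++ alt (suc k) x y)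
        ≤-length v′<v = subst₂ ℕ._≤_ (sym (length-++-alt v′ k y x)) (sym (length-++-alt v (suc k) x y))
                                (ℕ.+-mono-≤ (ℕ.<⇒≤ v′<v) (ℕ.n≤1+n k))
      by-cases (inj₁ _) (inj₂ (v′ , vy≈v′ , v′<v)) =
        positive-or-descent-resp move-y (≤-length v′<v) (recurse v′<v (suc (suc k)))
        where
        move-y : M ∣ (v ++ alt (suc k) x y) ≈ (v′ ++ alt (suc (suc k)) y x)
        move-y = begin
          v ++ alt (suc k) x y              ≈⟨ ≈-++ (≈-unsnoc vy≈v′) ≈-refl ⟩
          (v′ ∷ʳ y) ++ alt (suc k) x y      ≡⟨ ++-assoc v′ (y ∷ []) (alt (suc k) x y) ⟩
          v′ ++ alt (suc (suc k)) y x       ∎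
        ≤-length : length v′ ℕ.< length v → length (v′ ++ alt (suc (suc k)) y x) ℕ.≤ length (v ++ alt (suc k) x y)
        ≤-length v′<v = subst₂ ℕ._≤_ (sym (trans (length-++-alt v′ (suc (suc k)) y x) (ℕ.+-suc (length v′) (suc k))))
                                     (sym (length-++-alt v (suc k) x y))
                                (ℕ.+-monoˡ-≤ (suc k) v′<v)

  positive-or-descent-commuting : ∀ {w a s} → a ≢ s → m M a s ≡ fin 2 →
                                  PositiveOrDescent w s → PositiveOrDescent (w ∷ʳ a) s
  positive-or-descent-commuting {w} {a} {s} a≢s m≡2 (inj₁ positive) =
    inj₁ λ i → subst (0ℤ ≤_) (sym (root-wa i)) (positive i)
    where
    root-wa : root (w ∷ʳ a) s ≗ root w s
    root-wa i = trans (cong (λ u → u i) (ρ-++ w (a ∷ []) (e s)))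
                      (ρ-cong w (reflect-orthogonal (e a) (e s) (e-orthogonal a≢s m≡2)) i)
  positive-or-descent-commuting {w} {a} {s} a≢s m≡2 (inj₂ (w′ , ws≈w′ , w′<w)) =
    inj₂ (w′ ∷ʳ a , swap , shorter-by-one)
    where
    open ≈-Reasoning
    swap : M ∣ (w ∷ʳ a ∷ʳ s) ≈ (w′ ∷ʳ a)
    swap = begin
      w ∷ʳ a ∷ʳ s        ≡⟨ ++-assoc w (a ∷ []) (s ∷ []) ⟩
      w ++ a ∷ s ∷ []    ≈⟨ ≈-++ (≈-refl {u = w}) (≈-sym (≈-commute a≢s m≡2)) ⟩
      w ++ s ∷ a ∷ []    ≡˘⟨ ++-assoc w (s ∷ []) (a ∷ []) ⟩
      w ∷ʳ s ∷ʳ a        ≈⟨ ≈-++ ws≈w′ ≈-refl ⟩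
      w′ ∷ʳ a            ∎
    shorter-by-one : length (w′ ∷ʳ a) ℕ.< length (w ∷ʳ a)
    shorter-by-one = subst₂ ℕ._<_ (sym (length-∷ʳ w′ a)) (sym (length-∷ʳ w a)) (s≤s w′<w)

  positive-or-descent-∷ʳ : ∀ w a s → (∀ u → length u ℕ.< length (w ∷ʳ a) → ∀ b → PositiveOrDescent u b) →
                           PositiveOrDescent (w ∷ʳ a) s
  positive-or-descent-∷ʳ w a s shorter = by-letter (a ≟ s)
    where
    w<wa : length w ℕ.< length (w ∷ʳ a)
    w<wa = length-<-∷ʳ w a

    repeated : PositiveOrDescent w a → PositiveOrDescent (w ∷ʳ a) a
    repeated (inj₁ _) = inj₂ (w , ≈-cancel w a , w<wa)
    repeated (inj₂ (w′ , wa≈w′ , w′<w)) =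
      positive-or-descent-resp wa≈w′ (ℕ.<⇒≤ (ℕ.<-trans w′<w w<wa)) (shorter w′ (ℕ.<-trans w′<w w<wa) a)

    by-entry : a ≢ s → m M a s ≡ fin 2 ⊎ m M a s ≡ ∞ → PositiveOrDescent (w ∷ʳ a) s
    by-entry a≢s (inj₁ m≡2) = positive-or-descent-commuting a≢s m≡2 (shorter w w<wa s)
    by-entry a≢s (inj₂ m≡∞) =
      alternating-positive-or-descent (w ∷ʳ a) shorter w (<-wellFounded (length w)) w<wa (a≢s , m≡∞) 1

    by-letter : Dec (a ≡ s) → PositiveOrDescent (w ∷ʳ a) s
    by-letter (yes refl) = repeated (shorter w w<wa a)
    by-letter (no a≢s)   = by-entry a≢s (right-angled a s a≢s)

  positive-or-descent : ∀ w → Acc ℕ._<_ (length w) → ∀ a → PositiveOrDescent w a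
  positive-or-descent w (acc rs) a with initLast w
  ... | []       = inj₁ (e-nonneg a)
  ... | w′ ∷ʳ′ b = positive-or-descent-∷ʳ w′ b a (λ u u<w → positive-or-descent u (rs u<w))

  ActsTrivially : Word n → Set
  ActsTrivially w = ∀ a → ρ w (e a) ≗ e a

  acts-trivially? : ∀ w → Dec (ActsTrivially w)
  acts-trivially? w = all? λ a → all? λ i → ρ w (e a) i ℤ.≟ e a i

  trivial-∷ʳ⇒root≡-1 : ∀ w a → ActsTrivially (w ∷ʳ a) → root w a a ≡ - 1ℤ
  trivial-∷ʳ⇒root≡-1 w a trivial = begin
    ρ w (e a) a                                       ≡˘⟨ ρ-cong w (reflect-involutive (e a) (e-unit a) (e a)) a ⟩
    ρ w (σ a (σ a (e a))) a                           ≡˘⟨ cong (λ u → u a) (ρ-++ w (a ∷ []) (σ a (e a))) ⟩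
    ρ (w ∷ʳ a) [ 1ℤ ∙ e a + - (+ 2 * B (e a) (e a)) ∙ e a ] a
      ≡⟨ ρ-linear (w ∷ʳ a) 1ℤ (e a) (- (+ 2 * B (e a) (e a))) (e a) a ⟩
    1ℤ * ρ (w ∷ʳ a) (e a) a + - (+ 2 * B (e a) (e a)) * ρ (w ∷ʳ a) (e a) a
      ≡⟨ cong₂ (λ x b → 1ℤ * x + - (+ 2 * b) * x) (trans (trivial a a) (e-diag a)) (e-unit a) ⟩
    1ℤ * 1ℤ + - (+ 2 * 1ℤ) * 1ℤ                        ≡⟨⟩
    - 1ℤ                                              ∎
    where open ≡-Reasoning

  faithful-acc : ∀ w → Acc ℕ._<_ (length w) → ActsTrivially w → M ∣ w ≈ []
  faithful-acc w (acc rs) trivial with initLast w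
  ... | []       = ≈-refl
  ... | w′ ∷ʳ′ a = by-cases (positive-or-descent w′ (<-wellFounded (length w′)) a)
    where
    by-cases : PositiveOrDescent w′ a → M ∣ (w′ ∷ʳ a) ≈ []
    by-cases (inj₁ positive) with () ← subst (0ℤ ≤_) (trivial-∷ʳ⇒root≡-1 w′ a trivial) (positive a)
    by-cases (inj₂ (w″ , w′a≈w″ , w″<w′)) =
      ≈-trans w′a≈w″ (faithful-acc w″ (rs (ℕ.<-trans w″<w′ (length-<-∷ʳ w′ a))) w″-trivial)
      where
      w″-trivial : ActsTrivially w″
      w″-trivial b i = trans (ρ-resp (≈-sym w′a≈w″) (e b) i) (trivial b i)

  faithful : ∀ {w} → ActsTrivially w → M ∣ w ≈ []
  faithful {w} = faithful-acc w (<-wellFounded (length w))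

  reflection-square : ∀ {t} → IsReflection M t → M ∣ (t ++ t) ≈ []
  reflection-square {t} (g , a , t≈gag⁻¹) = faithful λ b i →
    trans (cong (λ u → u i) (ρ-++ t t (e b)))
          (trans (ρ-reflection t≈gag⁻¹ (ρ t (e b)) i)
                 (trans (reflect-cong (root g a) (ρ-reflection t≈gag⁻¹ (e b)) i)
                        (reflect-involutive (root g a) (root-unit g a) (e b) i)))

module ReflectionProduct {n} (M : CoxeterMatrix n) (right-angled : RightAngled M)
                         {t t′ g g′ a a′} (t≈gag⁻¹ : M ∣ t ≈ (g ++ a ∷ inv g))
                         (t′≈g′a′g′⁻¹ : M ∣ t′ ≈ (g′ ++ a′ ∷ inv g′)) where

  open Representation M right-angled
  open Tits M right-angled
  open Rotation (root g a) (root g′ a′) (root-unit g a) (root-unit g′ a′)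

  ρ-power : ∀ l v → ρ ((t ++ t′) ^w l) v ≗ fold v rotation l
  ρ-power zero    v i = refl
  ρ-power (suc l) v i = begin
    ρ ((t ++ t′) ++ (t ++ t′) ^w l) v i      ≡⟨ cong (λ u → u i) (trans (ρ-++ (t ++ t′) _ v) (ρ-++ t t′ _)) ⟩
    ρ t (ρ t′ (ρ ((t ++ t′) ^w l) v)) i     ≡⟨ ρ-reflection t≈gag⁻¹ _ i ⟩
    reflect (root g a) (ρ t′ (ρ ((t ++ t′) ^w l) v)) i
      ≡⟨ reflect-cong (root g a)
           (λ j → trans (ρ-reflection t′≈g′a′g′⁻¹ _ j) (reflect-cong (root g′ a′) (ρ-power l v) j)) i ⟩
    rotation (fold v rotation l) i           ∎
    where open ≡-Reasoning

  finite-order⇒square-trivial : ∀ l → M ∣ ((t ++ t′) ^w suc l) ≈ [] → ActsTrivially ((t ++ t′) ^w 2)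
  finite-order⇒square-trivial l power≈[] b i =
    trans (ρ-power 2 (e b) i) (rotation-periodic⇒involutive l periodic (e b) i)
    where
    periodic : fold (root g′ a′) rotation (suc l) ≗ root g′ a′
    periodic j = trans (sym (ρ-power (suc l) (root g′ a′) j)) (ρ-resp power≈[] (root g′ a′) j)

proposition2p3 : (n : ℕ) (M : CoxeterMatrix n) →
    (∀ i j → i ≢ j → (m M i j ≡ fin 2) ⊎ (m M i j ≡ ∞)) →
    (t t′ : Word n) → IsReflection M t → IsReflection M t′ →
    ¬ (M ∣ t ≈ t′) →
    HasOrder M (t ++ t′) (fin 2) ⊎ HasOrder M (t ++ t′) ∞
proposition2p3 n M right-angled t t′ (g , a , t≈gag⁻¹) t′-reflection@(g′ , a′ , t′≈g′a′g′⁻¹) t≉t′ =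
  by-cases (acts-trivially? ((t ++ t′) ^w 2))
  where
  open WordCongruence M
  open Representation M right-angled
  open Tits M right-angled
  open ReflectionProduct M right-angled t≈gag⁻¹ t′≈g′a′g′⁻¹
  by-cases : Dec (ActsTrivially ((t ++ t′) ^w 2)) → HasOrder M (t ++ t′) (fin 2) ⊎ HasOrder M (t ++ t′) ∞
  by-cases (yes square-trivial)    = inj₁ (has-order-two (reflection-square t′-reflection) t≉t′ (faithful square-trivial))
  by-cases (no square-nontrivial) = inj₂ λ where
    (suc l) _ power≈[] → square-nontrivial (finite-order⇒square-trivial l power≈[])
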